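{- The Frobenius group $E_8\rtimes C_7$ (with kernel $E_8$ and complement $C_7$) and the Frobenius group $E_{16}\rtimes C_3$ (with kernel $E_{16}$ and complement $C_3$) are not Schur groups.
   Context: $E_n$ denotes the elementary abelian group of order $n$ and $C_n$ the cyclic group of order $n$. Schur group: for a finite group $G$ with identity $e$, an S-ring over $G$ is a subring $\mathcal A=\mathrm{Span}_{\mathbb Z}\{\underline X:X\in\mathcal S\}$ of $\mathbb ZG$ where $\mathcal S$ is a partition of $G$ with $\{e\}\in\mathcal S$ and $X^{ -1}\in\mathcal S$ for $X\in\mathcal S$, and $\underline X$ is the sum of the elements of $X$; it is schurian if $\mathcal S$ is the set of orbits of the stabilizer $\Gamma_e$ for some $\Gamma\le\mathrm{Sym}(G)$ containing the group of right multiplications; $G$ is a Schur group if every S-ring over $G$ is schurian. -}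

module Defs where

open import Data.Bool using (Bool; true; false; _xor_)
import Data.Bool as Bool
open import Data.Nat using (ℕ; zero; suc; _+_; _∸_)
import Data.Nat as ℕ
open import Data.Nat.DivMod using (_mod_)
open import Data.Fin using (Fin; toℕ)
import Data.Fin as Fin
open import Data.Vec using (Vec; []; _∷_)
import Data.Vec.Properties as VecP
open import Data.List using (List; []; _∷_; map; concatMap; cartesianProduct; filter; length)
import Data.List as List
open import Data.Product using (Σ; ∃; _×_; _,_)
import Data.Product.Properties as ProdP
open import Relation.Binary.PropositionalEquality using (_≡_)
open import Relation.Binary.Definitions using (DecidableEquality)
open import Relation.Nullary.Decidable using (_×-dec_)
open import Function.Bundles using (_↔_; Inverse)
open import Level using (0ℓ)

-- Concrete finite groups: a carrier with decidable equality, a list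
-- enumerating every element exactly once, multiplication, identity, inverse.

record FinGroup : Set₁ where
  field
    Carrier : Set
    _≟_     : DecidableEquality Carrier
    elems   : List Carrier
    _·_     : Carrier → Carrier → Carrier
    e       : Carrier
    inv     : Carrier → Carrier

-- S-rings, given by the partition S of G into the (nonempty) fibres of a
-- colouring c : G → ℕ.

module _ (G : FinGroup) where
  open FinGroup G

  -- number of pairs (x , y) with x in the class of colour a, y in the class
  -- of colour b and x·y = z : the coefficient of z in  X̲ · Y̲  in ℤG
  coeff : (Carrier → ℕ) → ℕ → ℕ → Carrier → ℕ
  coeff c a b z =
    length (filter (λ p → (c (Data.Product.proj₁ p) ℕ.≟ a)
                           ×-dec ((c (Data.Product.proj₂ p) ℕ.≟ b)
                           ×-dec ((Data.Product.proj₁ p · Data.Product.proj₂ p) ≟ z)))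
                   (cartesianProduct elems elems))

  record IsSRing (c : Carrier → ℕ) : Set where
    field
      identity-class : ∀ x → c x ≡ c e → x ≡ e
      inverse-class  : ∀ x y → (c x ≡ c y → c (inv x) ≡ c (inv y))
                             × (c (inv x) ≡ c (inv y) → c x ≡ c y)
      -- the ℤ-span of the X̲ is closed under multiplication: each X̲ · Y̲
      -- has coefficients constant on every basic set
      mult-closed    : ∀ a b z z' → c z ≡ c z' → coeff c a b z ≡ coeff c a b z'

  -- S is the set of orbits of the stabiliser Γ_e of some subgroup Γ of
  -- Sym(G) containing all right multiplications x ↦ x·g.
  -- Γ is given as a predicate on permutations of G.
  record Schurian (c : Carrier → ℕ) : Set₁ where
    field
      Γ       : (Carrier ↔ Carrier) → Set
      Γ-id    : ∃ λ ρ → Γ ρ × (∀ x → Inverse.to ρ x ≡ x)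
      Γ-comp  : ∀ σ τ → Γ σ → Γ τ →
                ∃ λ ρ → Γ ρ × (∀ x → Inverse.to ρ x ≡ Inverse.to σ (Inverse.to τ x))
      Γ-inv   : ∀ σ → Γ σ → ∃ λ ρ → Γ ρ × (∀ x → Inverse.to ρ x ≡ Inverse.from σ x)
      Γ-right : ∀ g → ∃ λ ρ → Γ ρ × (∀ x → Inverse.to ρ x ≡ x · g)
      orbits  : ∀ x y → (c x ≡ c y → ∃ λ σ → Γ σ × Inverse.to σ e ≡ e × Inverse.to σ x ≡ y)
                      × ((∃ λ σ → Γ σ × Inverse.to σ e ≡ e × Inverse.to σ x ≡ y) → c x ≡ c y)

  IsSchurGroup : Set₁
  IsSchurGroup = ∀ (c : Carrier → ℕ) → IsSRing c → Schurian c

-- Semidirect products E_{2^m} ⋊ C_k, where C_k = Fin k (addition mod k)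
-- acts on E_{2^m} = Vec Bool m via powers of a linear map f of order k:
--   (v , i) · (w , j) = (v + f^i w , i + j mod k)

allVecs : (m : ℕ) → List (Vec Bool m)
allVecs zero    = [] ∷ []
allVecs (suc m) = concatMap (λ b → map (b ∷_) (allVecs m)) (true ∷ false ∷ [])

vadd : ∀ {m} → Vec Bool m → Vec Bool m → Vec Bool m
vadd []       []       = []
vadd (a ∷ v) (b ∷ w) = (a xor b) ∷ vadd v w

vzero : ∀ m → Vec Bool m
vzero zero    = []
vzero (suc m) = false ∷ vzero m

iter : ∀ {A : Set} → ℕ → (A → A) → A → A
iter zero    f x = x
iter (suc n) f x = f (iter n f x)

semidirect : (m k : ℕ) .{{_ : ℕ.NonZero k}} → (Vec Bool m → Vec Bool m) → FinGroup
semidirect m k f = record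
  { Carrier = Vec Bool m × Fin k
  ; _≟_     = ProdP.≡-dec (VecP.≡-dec Bool._≟_) Fin._≟_
  ; elems   = cartesianProduct (allVecs m) (List.allFin k)
  ; _·_     = λ { (v , i) (w , j) → vadd v (iter (toℕ i) f w) , ((toℕ i + toℕ j) mod k) }
  ; e       = vzero m , (0 mod k)
  ; inv     = λ { (v , i) → iter (k ∸ toℕ i) f v , ((k ∸ toℕ i) mod k) }
  }

-- multiplication by a generator x of GF(8)^* = (F₂[x]/(x³+x+1))^*,
-- coordinates (a₀ , a₁ , a₂) ↦ a₀ + a₁x + a₂x² ; this has order 7 and acts
-- fixed-point-freely on E_8 ∖ {0}.
α8 : Vec Bool 3 → Vec Bool 3
α8 (a₀ ∷ a₁ ∷ a₂ ∷ []) = a₂ ∷ (a₀ xor a₂) ∷ a₁ ∷ []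

-- scalar multiplication by ω on GF(4)² (ω² = ω + 1),
-- coordinates (a , b , c , d) ↦ (a + bω , c + dω); order 3, fixed-point-free.
ω16 : Vec Bool 4 → Vec Bool 4
ω16 (a ∷ b ∷ c ∷ d ∷ []) = b ∷ (a xor b) ∷ d ∷ (c xor d) ∷ []

E8⋊C7 : FinGroup
E8⋊C7 = semidirect 3 7 α8

E16⋊C3 : FinGroup
E16⋊C3 = semidirect 4 3 ω16

-- For each group we exhibit an S-ring (a colouring c of the group) that is not
-- schurian.  The argument has three general parts.
--
--  1. If the partition of c is the orbit partition of Γ_e, where Γ contains all
--     right multiplications, then every σ ∈ Γ is an automorphism of the
--     colour scheme:  c (σ w · (σ u)⁻¹) = c (w · u⁻¹)  for all u, w.  Hence any
--     two elements x, y of the same colour are related by such an automorphism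
--     with σ e = e and σ x = y.
--  2. A backtracking search, assigning images to the elements one at a time,
--     can refute the existence of a colour automorphism extending a given
--     partial map; its soundness is proved once and for all.
--  3. The S-ring axioms and the group laws used in (1) are decidable for an
--     enumerated finite group.  To make the multiplication axiom cheap to
--     decide, the coefficient of z in X̲_a · X̲_b is first shown to count the
--     x of colour a with x⁻¹ · z of colour b.

module Submission where

open import Defs
open import Data.Bool using (Bool; true; false; T; not; _∨_)
import Data.Bool as Bool
open import Data.Bool.ListAction using (all)
import Data.Nat as ℕ
open import Data.Nat using (ℕ; zero; suc; _+_; _<_; _≡ᵇ_; _<ᵇ_; _<?_)
open import Data.Nat.Properties using (≡ᵇ⇒≡; ≡⇒≡ᵇ; <ᵇ⇒<)
open import Data.Fin using (zero; suc)
open import Data.Vec using (Vec; []; _∷_; lookup)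
open import Data.List using (List; []; _∷_; _++_; map; upTo; cartesianProduct; filter; length)
open import Data.List.Properties using (filter-none; filter-accept; filter-reject; filter-++; filter-≐; length-++)
open import Data.List.Membership.Propositional using (_∈_)
open import Data.List.Membership.Propositional.Properties
  using (∈-cartesianProduct⁺; ∈-allFin; ∈-map⁺; ∈-++⁺ˡ; ∈-++⁺ʳ; ∈-upTo⁺)
open import Data.List.Relation.Unary.Any using (here)
open import Data.List.Relation.Unary.All using (All; []; _∷_; tabulate)
import Data.List.Relation.Unary.All as All
open import Data.List.Relation.Unary.All.Properties using (all⁺; all⁻)
open import Data.Product using (∃; _×_; _,_; proj₁; proj₂)
open import Function using (_∘_)
open import Function.Bundles using (Inverse)
open import Relation.Nullary using (¬_; yes; no; does)
open import Relation.Nullary.Decidable using (⌊_⌋; toWitness; _×-dec_)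
open import Relation.Unary using (Decidable)
open import Relation.Binary.PropositionalEquality
  using (_≡_; _≢_; refl; sym; trans; cong; cong₂; subst; module ≡-Reasoning)

holdsOn : ∀ {A : Set} (p : A → Bool) (xs : List A) → T (all p xs) → ∀ {x} → x ∈ xs → T (p x)
holdsOn p xs h = All.lookup (all⁺ p xs h)

modusPonensᵇ : ∀ {a b} → T (not a ∨ b) → T a → T b
modusPonensᵇ {true} h _ = h

length-filter-map : ∀ {A B : Set} {P : B → Set} (P? : Decidable P) (f : A → B) xs →
                    length (filter P? (map f xs)) ≡ length (filter (P? ∘ f) xs)
length-filter-map P? f []       = refl
length-filter-map P? f (x ∷ xs) with does (P? (f x))
... | true  = cong suc (length-filter-map P? f xs)
... | false = length-filter-map P? f xs

count-pairs : ∀ {A B : Set} {P : A × B → Set} {Q : A → Set}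
              (P? : Decidable P) (Q? : Decidable Q) xs ys →
              (∀ x → length (filter (λ y → P? (x , y)) ys) ≡ length (filter Q? (x ∷ []))) →
              length (filter P? (cartesianProduct xs ys)) ≡ length (filter Q? xs)
count-pairs P? Q? []       ys fibre = refl
count-pairs P? Q? (x ∷ xs) ys fibre = begin
  length (filter P? (map (x ,_) ys ++ cartesianProduct xs ys))
    ≡⟨ cong length (filter-++ P? (map (x ,_) ys) _) ⟩
  length (filter P? (map (x ,_) ys) ++ filter P? (cartesianProduct xs ys))
    ≡⟨ length-++ (filter P? (map (x ,_) ys)) ⟩
  length (filter P? (map (x ,_) ys)) + length (filter P? (cartesianProduct xs ys))
    ≡⟨ cong₂ _+_ (trans (length-filter-map P? (x ,_) ys) (fibre x))
                 (count-pairs P? Q? xs ys fibre) ⟩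
  length (filter Q? (x ∷ [])) + length (filter Q? xs)
    ≡⟨ length-++ (filter Q? (x ∷ [])) ⟨
  length (filter Q? (x ∷ []) ++ filter Q? xs)
    ≡⟨ cong length (filter-++ Q? (x ∷ []) xs) ⟨
  length (filter Q? (x ∷ xs)) ∎
  where open ≡-Reasoning

record DivisionLaws (G : FinGroup) : Set where
  open FinGroup G
  field
    identityˡ : ∀ u → e · u ≡ u
    inverseʳ  : ∀ u → u · inv u ≡ e
    cancelʳ   : ∀ w u → (w · inv u) · u ≡ w
    cancelˡ   : ∀ u w → inv u · (u · w) ≡ w
    divideˡ   : ∀ u w → u · (inv u · w) ≡ w

module _ (G : FinGroup) (c : FinGroup.Carrier G → ℕ) where
  open FinGroup G

  -- σ preserves the colours of all "quotients" w · u⁻¹, i.e. σ is an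
  -- automorphism of the Cayley colour scheme of the partition of c.
  IsColourAutomorphism : (Carrier → Carrier) → Set
  IsColourAutomorphism σ = ∀ u w → c (σ w · inv (σ u)) ≡ c (w · inv u)

-- Part 1.  Schurian colourings have colour automorphisms fixing e that act
-- transitively on each colour class.

module SchurianAutomorphisms {G : FinGroup} (laws : DivisionLaws G)
                             {c : FinGroup.Carrier G → ℕ} (S : Schurian G c) where
  open FinGroup G
  open DivisionLaws laws
  open Schurian S

  InΓ : (Carrier → Carrier) → Set
  InΓ f = ∃ λ ρ → Γ ρ × (∀ x → Inverse.to ρ x ≡ f x)

  InΓ-∘ : ∀ {f g} → InΓ f → InΓ g → InΓ (f ∘ g)
  InΓ-∘ {f} (ρ , ρ∈Γ , ρ≗f) (τ , τ∈Γ , τ≗g) =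
    let (π , π∈Γ , π≗ρτ) = Γ-comp ρ τ ρ∈Γ τ∈Γ
    in π , π∈Γ , λ x → trans (π≗ρτ x) (trans (ρ≗f _) (cong f (τ≗g x)))

  stabiliser-preserves-colour : ∀ {f} → InΓ f → f e ≡ e → ∀ x → c (f x) ≡ c x
  stabiliser-preserves-colour {f} (ρ , ρ∈Γ , ρ≗f) fe≡e x =
    sym (proj₂ (orbits x (f x)) (ρ , ρ∈Γ , trans (ρ≗f e) fe≡e , ρ≗f x))

  -- σ ∈ Γ is a colour automorphism: x ↦ σ (x · u) · (σ u)⁻¹ lies in Γ_e and
  -- sends w · u⁻¹ to σ w · (σ u)⁻¹.
  automorphism : ∀ σ → Γ σ → IsColourAutomorphism G c (Inverse.to σ)
  automorphism σ σ∈Γ u w =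
    trans (cong (λ v → c (σ' v · inv (σ' u))) (sym (cancelʳ w u)))
          (stabiliser-preserves-colour ρ∈Γ ρe≡e (w · inv u))
    where
      σ' = Inverse.to σ
      ρ∈Γ : InΓ (λ x → σ' (x · u) · inv (σ' u))
      ρ∈Γ = InΓ-∘ (Γ-right (inv (σ' u))) (InΓ-∘ (σ , σ∈Γ , λ _ → refl) (Γ-right u))
      ρe≡e : σ' (e · u) · inv (σ' u) ≡ e
      ρe≡e = trans (cong (λ v → σ' v · inv (σ' u)) (identityˡ u)) (inverseʳ (σ' u))

  transitive : ∀ x y → c x ≡ c y →
               ∃ λ σ → IsColourAutomorphism G c σ × σ e ≡ e × σ x ≡ y
  transitive x y cx≡cy =
    let (σ , σ∈Γ , σe≡e , σx≡y) = proj₁ (orbits x y) cx≡cy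
    in Inverse.to σ , automorphism σ σ∈Γ , σe≡e , σx≡y

-- Part 2.  A backtracking search over the group that refutes the existence
-- of a colour automorphism extending a given partial map.

module ColourSearch (G : FinGroup) (c : FinGroup.Carrier G → ℕ) where
  open FinGroup G

  PartialMap : Set
  PartialMap = List (Carrier × Carrier)

  Extends : (Carrier → Carrier) → PartialMap → Set
  Extends σ s = All (λ ab → σ (proj₁ ab) ≡ proj₂ ab) s

  compatible : PartialMap → Carrier → Carrier → Bool
  compatible s z w = all (λ ab → c (w · inv (proj₂ ab)) ≡ᵇ c (z · inv (proj₁ ab))) s

  -- T (refutes zs s): no colour automorphism extends s.  Each element of zs
  -- in turn is tried against every compatible image.
  refutes : List Carrier → PartialMap → Bool
  refutes []       s = false
  refutes (z ∷ zs) s =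
    all (λ w → not (compatible s z w) ∨ refutes zs ((z , w) ∷ s)) elems

  compatible-image : ∀ {σ} → IsColourAutomorphism G c σ →
                     ∀ {s} → Extends σ s → ∀ z → T (compatible s z (σ z))
  compatible-image {σ} aut ext z = all⁻ _ (respects ext)
    where
      respects : ∀ {s} → Extends σ s →
                 All (λ ab → T (c (σ z · inv (proj₂ ab)) ≡ᵇ c (z · inv (proj₁ ab)))) s
      respects []                      = []
      respects {(a , _) ∷ _} (refl ∷ ext) = ≡⇒≡ᵇ _ _ (aut a z) ∷ respects ext

  -- Soundness of the search: a successful refutation contradicts any colour
  -- automorphism extending s, since σ z is one of the images tried for z.
  refutes-sound : ∀ {σ} → IsColourAutomorphism G c σ →
                  (complete : ∀ g → g ∈ elems) →
                  ∀ zs {s} → Extends σ s → ¬ T (refutes zs s)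
  refutes-sound aut complete []       ext ()
  refutes-sound aut complete (z ∷ zs) ext h =
    refutes-sound aut complete zs (refl ∷ ext)
      (modusPonensᵇ (holdsOn _ elems h (complete _)) (compatible-image aut ext z))

-- Part 3.  Decision procedures for properties of an enumerated finite group.

module Checks (G : FinGroup) (complete : ∀ g → g ∈ FinGroup.elems G) where
  open FinGroup G

  everywhere : (p : Carrier → Bool) → T (all p elems) → ∀ x → T (p x)
  everywhere p h x = holdsOn p elems h (complete x)

  everywhere₂ : (p : Carrier → Carrier → Bool) →
                T (all (λ x → all (p x) elems) elems) → ∀ x y → T (p x y)
  everywhere₂ p h x = everywhere (p x) (everywhere _ h x)

  _≡?_ : Carrier → Carrier → Bool
  x ≡? y = ⌊ x ≟ y ⌋

  identityˡ-check inverseʳ-check cancelʳ-check cancelˡ-check divideˡ-check : Bool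
  identityˡ-check = all (λ u → (e · u) ≡? u) elems
  inverseʳ-check  = all (λ u → (u · inv u) ≡? e) elems
  cancelʳ-check   = all (λ w → all (λ u → ((w · inv u) · u) ≡? w) elems) elems
  cancelˡ-check   = all (λ u → all (λ w → (inv u · (u · w)) ≡? w) elems) elems
  divideˡ-check   = all (λ u → all (λ w → (u · (inv u · w)) ≡? w) elems) elems

  divisionLaws : T identityˡ-check → T inverseʳ-check → T cancelʳ-check →
                 T cancelˡ-check → T divideˡ-check → DivisionLaws G
  divisionLaws h₁ h₂ h₃ h₄ h₅ = record
    { identityˡ = λ u → toWitness (everywhere _ h₁ u)
    ; inverseʳ  = λ u → toWitness (everywhere _ h₂ u)
    ; cancelʳ   = λ w u → toWitness (everywhere₂ _ h₃ w u)
    ; cancelˡ   = λ u w → toWitness (everywhere₂ _ h₄ u w)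
    ; divideˡ   = λ u w → toWitness (everywhere₂ _ h₅ u w)
    }

  listed-once-check : Bool
  listed-once-check = all (λ w → length (filter (_≟ w) elems) ≡ᵇ 1) elems

  module Coefficients (c : Carrier → ℕ) where

    pairTest : ∀ a b z → Decidable (λ (p : Carrier × Carrier) →
                 c (proj₁ p) ≡ a × c (proj₂ p) ≡ b × proj₁ p · proj₂ p ≡ z)
    pairTest a b z p =
      (c (proj₁ p) ℕ.≟ a) ×-dec ((c (proj₂ p) ℕ.≟ b) ×-dec ((proj₁ p · proj₂ p) ≟ z))

    quotientTest : ∀ a b z → Decidable (λ x → c x ≡ a × c (inv x · z) ≡ b)
    quotientTest a b z x = (c x ℕ.≟ a) ×-dec (c (inv x · z) ℕ.≟ b)

    quotientCount : ℕ → ℕ → Carrier → ℕ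
    quotientCount a b z = length (filter (quotientTest a b z) elems)

    quotientCount-absentˡ : ∀ {a} → (∀ x → c x ≢ a) → ∀ b z → quotientCount a b z ≡ 0
    quotientCount-absentˡ absent b z =
      cong length (filter-none (quotientTest _ b z) {elems} (tabulate λ {x} _ (ca , _) → absent x ca))

    quotientCount-absentʳ : ∀ {b} → (∀ x → c x ≢ b) → ∀ a z → quotientCount a b z ≡ 0
    quotientCount-absentʳ absent a z =
      cong length (filter-none (quotientTest a _ z) {elems} (tabulate λ {x} _ (_ , cb) → absent _ cb))

    -- The coefficient of z in X̲_a · X̲_b: the pairs (x , y) are determined by
    -- x, since x · y = z exactly when y = x⁻¹ · z.
    coeff-formula : DivisionLaws G → T listed-once-check →
                    ∀ a b z → coeff G c a b z ≡ quotientCount a b z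
    coeff-formula laws once a b z =
      count-pairs (pairTest a b z) (quotientTest a b z) elems elems fibre
      where
        open DivisionLaws laws
        partner : ∀ {x y} → x · y ≡ z → y ≡ inv x · z
        partner {x} xy≡z = trans (sym (cancelˡ x _)) (cong (inv x ·_) xy≡z)

        fibre : ∀ x → length (filter (λ y → pairTest a b z (x , y)) elems)
                    ≡ length (filter (quotientTest a b z) (x ∷ []))
        fibre x with quotientTest a b z x
        ... | yes q@(ca , cb) = begin
          length (filter (λ y → pairTest a b z (x , y)) elems)
            ≡⟨ cong length (filter-≐ (λ y → pairTest a b z (x , y)) (_≟ (inv x · z))
                                      ((λ (_ , _ , xy≡z) → partner xy≡z)
                                      , (λ { refl → ca , cb , divideˡ x z }))
                                      elems) ⟩
          length (filter (_≟ (inv x · z)) elems)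
            ≡⟨ ≡ᵇ⇒≡ _ _ (everywhere _ once (inv x · z)) ⟩
          1
            ≡⟨ cong length (filter-accept (quotientTest a b z) q) ⟨
          length (filter (quotientTest a b z) (x ∷ [])) ∎
          where open ≡-Reasoning
        ... | no ¬q = trans
          (cong length (filter-none (λ y → pairTest a b z (x , y)) {elems}
            (tabulate λ _ (ca , cy , xy≡z) → ¬q (ca , subst (λ y → c y ≡ b) (partner xy≡z) cy))))
          (sym (cong length (filter-reject (quotientTest a b z) ¬q)))

  -- The colours
  -- are assumed to lie below K, and rep k is a chosen element of colour k;
  -- closure under multiplication is tested, through coeff-formula, by
  -- comparing each coefficient of X̲_a · X̲_b with the one at the
  -- representative of the same colour.
  module SRingChecks (c : Carrier → ℕ) (K : ℕ) (rep : ℕ → Carrier)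
                     (laws : DivisionLaws G) (once : T listed-once-check) where
    open Coefficients c

    identity-class-check inverse-class-check colour-bound-check mult-closed-check : Bool
    identity-class-check = all (λ x → not (c x ≡ᵇ c e) ∨ (x ≡? e)) elems
    inverse-class-check  =
      all (λ x → all (λ y → ⌊ (c x ≡ᵇ c y) Bool.≟ (c (inv x) ≡ᵇ c (inv y)) ⌋) elems) elems
    colour-bound-check   = all (λ x → c x <ᵇ K) elems
    mult-closed-check    =
      all (λ a → all (λ b → all (λ z → quotientCount a b z ≡ᵇ quotientCount a b (rep (c z)))
                                elems) (upTo K)) (upTo K)

    module _ (bounded : T colour-bound-check) (closed : T mult-closed-check) where

      absent : ∀ {a} → ¬ a < K → ∀ x → c x ≢ a
      absent a≮K x refl = a≮K (<ᵇ⇒< _ _ (everywhere _ bounded x))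

      count-at-rep : ∀ a b z → quotientCount a b z ≡ quotientCount a b (rep (c z))
      count-at-rep a b z with a <? K | b <? K
      ... | yes a<K | yes b<K =
        ≡ᵇ⇒≡ _ _ (everywhere _ (holdsOn _ _ (holdsOn _ _ closed (∈-upTo⁺ a<K)) (∈-upTo⁺ b<K)) z)
      ... | no a≮K | _ =
        trans (quotientCount-absentˡ (absent a≮K) b z)
              (sym (quotientCount-absentˡ (absent a≮K) b _))
      ... | yes _ | no b≮K =
        trans (quotientCount-absentʳ (absent b≮K) a z)
              (sym (quotientCount-absentʳ (absent b≮K) a _))

    sRing : T identity-class-check → T inverse-class-check →
            T colour-bound-check → T mult-closed-check → IsSRing G c
    sRing idc invc bounded closed = record
      { identity-class = λ x cx≡ce →
          toWitness (modusPonensᵇ (everywhere _ idc x) (≡⇒≡ᵇ _ _ cx≡ce))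
      ; inverse-class  = λ x y →
          let same = toWitness (everywhere₂ _ invc x y)
          in (λ cx≡cy → ≡ᵇ⇒≡ _ _ (subst T same (≡⇒≡ᵇ _ _ cx≡cy)))
           , (λ cix≡ciy → ≡ᵇ⇒≡ _ _ (subst T (sym same) (≡⇒≡ᵇ _ _ cix≡ciy)))
      ; mult-closed    = λ a b z z' cz≡cz' → begin
          coeff G c a b z                    ≡⟨ coeff-formula laws once a b z ⟩
          quotientCount a b z                ≡⟨ count-at-rep bounded closed a b z ⟩
          quotientCount a b (rep (c z))      ≡⟨ cong (quotientCount a b ∘ rep) cz≡cz' ⟩
          quotientCount a b (rep (c z'))     ≡⟨ count-at-rep bounded closed a b z' ⟨
          quotientCount a b z'               ≡⟨ coeff-formula laws once a b z' ⟨
          coeff G c a b z'                   ∎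
      }
      where open ≡-Reasoning

notSchurGroup : ∀ G → DivisionLaws G → (complete : ∀ g → g ∈ FinGroup.elems G) →
                ∀ c → IsSRing G c → ∀ x y → c x ≡ c y →
                let open FinGroup G in
                T (ColourSearch.refutes G c elems ((e , e) ∷ (x , y) ∷ [])) →
                ¬ IsSchurGroup G
notSchurGroup G laws complete c sRing x y cx≡cy refuted schur =
  let (σ , aut , σe≡e , σx≡y) = SchurianAutomorphisms.transitive laws (schur c sRing) x y cx≡cy
  in ColourSearch.refutes-sound G c aut complete (FinGroup.elems G) (σe≡e ∷ σx≡y ∷ []) refuted

allVecs-complete : ∀ {m} (v : Vec Bool m) → v ∈ allVecs m
allVecs-complete []          = here refl
allVecs-complete (true ∷ v)  = ∈-++⁺ˡ (∈-map⁺ (true ∷_) (allVecs-complete v))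
allVecs-complete {suc m} (false ∷ v) =
  ∈-++⁺ʳ (map (true ∷_) (allVecs m)) (∈-++⁺ˡ (∈-map⁺ (false ∷_) (allVecs-complete v)))

semidirect-complete : ∀ m k .{{_ : ℕ.NonZero k}} f g → g ∈ FinGroup.elems (semidirect m k f)
semidirect-complete m k f (v , i) = ∈-cartesianProduct⁺ (allVecs-complete v) (∈-allFin i)

-- Colour 0 is {e}; the kernel E₈ ∖ {0} splits into
-- the class 1 of the four vectors with a₀ = 1 and the class 4 of the three
-- nonzero vectors with a₀ = 0; the 48 elements outside the kernel split into
-- the classes 2 and 3 of size 24 each.
colour8 : FinGroup.Carrier E8⋊C7 → ℕ
colour8 (v , i) = lookup (row v) i
  where
    row : Vec Bool 3 → Vec ℕ 7
    row (true  ∷ true  ∷ true  ∷ []) = 1 ∷ 2 ∷ 3 ∷ 2 ∷ 3 ∷ 2 ∷ 3 ∷ []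
    row (true  ∷ true  ∷ false ∷ []) = 1 ∷ 3 ∷ 2 ∷ 2 ∷ 3 ∷ 3 ∷ 2 ∷ []
    row (true  ∷ false ∷ true  ∷ []) = 1 ∷ 3 ∷ 3 ∷ 3 ∷ 2 ∷ 2 ∷ 2 ∷ []
    row (true  ∷ false ∷ false ∷ []) = 1 ∷ 2 ∷ 2 ∷ 3 ∷ 2 ∷ 3 ∷ 3 ∷ []
    row (false ∷ true  ∷ true  ∷ []) = 4 ∷ 2 ∷ 3 ∷ 3 ∷ 3 ∷ 3 ∷ 2 ∷ []
    row (false ∷ true  ∷ false ∷ []) = 4 ∷ 3 ∷ 2 ∷ 3 ∷ 3 ∷ 2 ∷ 3 ∷ []
    row (false ∷ false ∷ true  ∷ []) = 4 ∷ 3 ∷ 3 ∷ 2 ∷ 2 ∷ 3 ∷ 3 ∷ []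
    row (false ∷ false ∷ false ∷ []) = 0 ∷ 2 ∷ 2 ∷ 2 ∷ 2 ∷ 2 ∷ 2 ∷ []

module E8 where
  open FinGroup E8⋊C7 using (Carrier; e)
  open Checks E8⋊C7 (semidirect-complete 3 7 α8)

  laws : DivisionLaws E8⋊C7
  laws = divisionLaws _ _ _ _ _

  representative : ℕ → Carrier
  representative 1 = (true  ∷ true  ∷ true  ∷ []) , zero
  representative 2 = (false ∷ false ∷ false ∷ []) , suc zero
  representative 3 = (true  ∷ true  ∷ true  ∷ []) , suc (suc zero)
  representative 4 = (false ∷ true  ∷ true  ∷ []) , zero
  representative _ = e

  open SRingChecks colour8 5 representative laws _

  isSRing : IsSRing E8⋊C7 colour8
  isSRing = sRing _ _ _ _

  notSchur : ¬ IsSchurGroup E8⋊C7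
  notSchur = notSchurGroup E8⋊C7 laws (semidirect-complete 3 7 α8)
               colour8 isSRing
               ((true ∷ true  ∷ true  ∷ []) , zero)
               ((true ∷ false ∷ false ∷ []) , zero)
               refl _

-- Colour 0 is {e}; the kernel E₁₆ ∖ {0} splits into
-- the classes 1, 4, 5 of sizes 6, 3, 6, and the 32 elements outside the kernel
-- into the classes 2, 3 of sizes 24, 8.
colour16 : FinGroup.Carrier E16⋊C3 → ℕ
colour16 (v , i) = lookup (row v) i
  where
    row : Vec Bool 4 → Vec ℕ 3
    row (true  ∷ true  ∷ true  ∷ true  ∷ []) = 1 ∷ 2 ∷ 2 ∷ []
    row (true  ∷ true  ∷ true  ∷ false ∷ []) = 1 ∷ 2 ∷ 3 ∷ []
    row (true  ∷ true  ∷ false ∷ true  ∷ []) = 1 ∷ 3 ∷ 2 ∷ []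
    row (true  ∷ true  ∷ false ∷ false ∷ []) = 4 ∷ 3 ∷ 3 ∷ []
    row (true  ∷ false ∷ true  ∷ true  ∷ []) = 4 ∷ 2 ∷ 2 ∷ []
    row (true  ∷ false ∷ true  ∷ false ∷ []) = 5 ∷ 2 ∷ 2 ∷ []
    row (true  ∷ false ∷ false ∷ true  ∷ []) = 1 ∷ 3 ∷ 2 ∷ []
    row (true  ∷ false ∷ false ∷ false ∷ []) = 5 ∷ 3 ∷ 2 ∷ []
    row (false ∷ true  ∷ true  ∷ true  ∷ []) = 4 ∷ 2 ∷ 2 ∷ []
    row (false ∷ true  ∷ true  ∷ false ∷ []) = 1 ∷ 2 ∷ 3 ∷ []
    row (false ∷ true  ∷ false ∷ true  ∷ []) = 5 ∷ 2 ∷ 2 ∷ []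
    row (false ∷ true  ∷ false ∷ false ∷ []) = 5 ∷ 2 ∷ 3 ∷ []
    row (false ∷ false ∷ true  ∷ true  ∷ []) = 1 ∷ 2 ∷ 2 ∷ []
    row (false ∷ false ∷ true  ∷ false ∷ []) = 5 ∷ 2 ∷ 2 ∷ []
    row (false ∷ false ∷ false ∷ true  ∷ []) = 5 ∷ 2 ∷ 2 ∷ []
    row (false ∷ false ∷ false ∷ false ∷ []) = 0 ∷ 2 ∷ 2 ∷ []

module E16 where
  open FinGroup E16⋊C3 using (Carrier; e)
  open Checks E16⋊C3 (semidirect-complete 4 3 ω16)

  laws : DivisionLaws E16⋊C3
  laws = divisionLaws _ _ _ _ _

  representative : ℕ → Carrier
  representative 1 = (true  ∷ true  ∷ true  ∷ true  ∷ []) , zero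
  representative 2 = (false ∷ false ∷ false ∷ false ∷ []) , suc zero
  representative 3 = (true  ∷ true  ∷ true  ∷ false ∷ []) , suc (suc zero)
  representative 4 = (true  ∷ true  ∷ false ∷ false ∷ []) , zero
  representative 5 = (true  ∷ false ∷ true  ∷ false ∷ []) , zero
  representative _ = e

  open SRingChecks colour16 6 representative laws _

  isSRing : IsSRing E16⋊C3 colour16
  isSRing = sRing _ _ _ _

  notSchur : ¬ IsSchurGroup E16⋊C3
  notSchur = notSchurGroup E16⋊C3 laws (semidirect-complete 4 3 ω16)
               colour16 isSRing
               ((false ∷ false ∷ true ∷ false ∷ []) , suc (suc zero))
               ((true  ∷ true  ∷ true  ∷ true  ∷ []) , suc zero)
               refl _

lemma3p6 : ¬ IsSchurGroup E8⋊C7 × ¬ IsSchurGroup E16⋊C3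
lemma3p6 = E8.notSchur , E16.notSchur
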